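{- Let $G,G'$ be passable games over a poset $A$ and $H,H'$ passable games over a poset $B$. Then (a) $G\triangleright G'$ and $H\le H'$ imply $G+H\triangleright G'+H'$; (b) $G\le G'$ and $H\triangleright H'$ imply $G+H\triangleright G'+H'$; (c) $G\le G'$ and $H\le H'$ imply $G+H\le G'+H'$. In particular, if $G\equiv G'$ and $H\equiv H'$, then $G+H\equiv G'+H'$.
   Context: Games over a poset $A$: $[a]$ atomic for $a\in A$; $\{L\mid R\}$ composite for non-empty sets $L,R$ of games (left and right options); atomic games have no options. $G\le H$ iff (1) every $G^L\triangleright H$, (2) every right option $H^R$ of $H$ has $G\triangleright H^R$, (3) if $G$ or $H$ atomic then $G\triangleright H$; $G\triangleright H$ iff (1) some $G^R\le H$, or (2) some left option $H^L$ of $H$ with $G\le H^L$, or (3) $G=[a],H=[b]$ atomic, $a\le b$. $G\equiv H$ iff $G\le H$ and $H\le G$. $G$ is passable if $G\triangleright G$ and all options of $G$ are passable (recursively). Sum: for $G$ over $A$ and $H$ over $B$, $G+H$ is the game over $A\times B$ (ordered componentwise) defined recursively by $[a]+[b]=[(a,b)]$ when both are atomic, and otherwise $G+H=\{G^L+H,\,G+H^L\mid G^R+H,\,G+H^R\}$ (an atomic summand contributes no options). -}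

module Defs where

open import Level using (Level; _⊔_; 0ℓ) renaming (suc to lsuc)
open import Data.Product using (Σ; _×_; _,_)
open import Data.Sum using (_⊎_; inj₁; inj₂; [_,_])

-- A composite game {L | R} is given by
-- (small) index types I, J for its left/right options, together with
-- witnesses that they are non-empty, and the option families.
data Game {a : Level} (X : Set a) : Set (a ⊔ lsuc 0ℓ) where
  atom : X → Game X
  comp : (I J : Set) → I → J → (I → Game X) → (J → Game X) → Game X

module _ {a ℓ : Level} {X : Set a} (_≼_ : X → X → Set ℓ) where

  -- G ≤ H  and  G ▷ H  (relative to the order _≼_ on atoms), mutually recursive.
  mutual
    Le : Game X → Game X → Set (a ⊔ ℓ)
    Le (atom x) (atom y) = Tr (atom x) (atom y)
    Le (atom x) (comp I J i j L R) =
      (∀ r → Tr (atom x) (R r)) × Tr (atom x) (comp I J i j L R)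
    Le (comp I J i j L R) (atom y) =
      (∀ l → Tr (L l) (atom y)) × Tr (comp I J i j L R) (atom y)
    Le (comp I J i j L R) (comp I' J' i' j' L' R') =
      (∀ l → Tr (L l) (comp I' J' i' j' L' R')) ×
      (∀ r → Tr (comp I J i j L R) (R' r))

    Tr : Game X → Game X → Set (a ⊔ ℓ)
    Tr (atom x) (atom y) = Lift′ (x ≼ y)
    Tr (atom x) (comp I J i j L R) = Σ I λ l → Le (atom x) (L l)
    Tr (comp I J i j L R) (atom y) = Σ J λ r → Le (R r) (atom y)
    Tr (comp I J i j L R) (comp I' J' i' j' L' R') =
      (Σ J λ r → Le (R r) (comp I' J' i' j' L' R')) ⊎
      (Σ I' λ l → Le (comp I J i j L R) (L' l))

    Lift′ : Set ℓ → Set (a ⊔ ℓ)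
    Lift′ P = Level.Lift a P

  Equiv : Game X → Game X → Set (a ⊔ ℓ)
  Equiv G H = Le G H × Le H G

  Passable : Game X → Set (a ⊔ ℓ)
  Passable (atom x) = Tr (atom x) (atom x)
  Passable (comp I J i j L R) =
    Tr (comp I J i j L R) (comp I J i j L R) ×
    ((∀ l → Passable (L l)) × (∀ r → Passable (R r)))

ProdRel : {a b ℓ₁ ℓ₂ : Level} {X : Set a} {Y : Set b} →
          (X → X → Set ℓ₁) → (Y → Y → Set ℓ₂) → (X × Y) → (X × Y) → Set (ℓ₁ ⊔ ℓ₂)
ProdRel R S (x , y) (x' , y') = R x x' × S y y'

infixl 6 _⊕_
_⊕_ : {a b : Level} {X : Set a} {Y : Set b} → Game X → Game Y → Game (X × Y)
atom x ⊕ atom y = atom (x , y)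
atom x ⊕ comp I J i j L R = comp I J i j (λ l → atom x ⊕ L l) (λ r → atom x ⊕ R r)
comp I J i j L R ⊕ atom y = comp I J i j (λ l → L l ⊕ atom y) (λ r → R r ⊕ atom y)
comp I J i j L R ⊕ comp I' J' i' j' L' R' =
  comp (I ⊎ I') (J ⊎ J') (inj₁ i) (inj₁ j)
    [ (λ l → L l ⊕ comp I' J' i' j' L' R') , (λ l → comp I J i j L R ⊕ L' l) ]
    [ (λ r → R r ⊕ comp I' J' i' j' L' R') , (λ r → comp I J i j L R ⊕ R' r) ]

module Submission where

open import Defs
open import Level using (Level; _⊔_; 0ℓ; lift; lower) renaming (suc to lsuc)
open import Data.Empty using (⊥)
open import Data.Product using (_×_; _,_; proj₁)
open import Data.Sum using (_⊎_; inj₁; inj₂; [_,_])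
open import Function using (_∘_)
open import Relation.Binary.Definitions using (Transitive)
open import Relation.Binary.Bundles using (Poset)

-- The options of G + H are G^L + H, G + H^L,
-- G^R + H and G + H^R, so every option clause of ≤ or ▷ for the sums follows
-- from an induction hypothesis.  The one remaining case is clause (3) of
-- G ▷ G', i.e. G = [a], G' = [b] with a ≤ b: then G + H ▷ G' + H' needs
-- H ▷ H', which follows from H ≤ H' ▷ H' by transitivity of the game order.
-- This is the only place where passability is used; (b) is symmetric.

module _ {a : Level} {X : Set a} where

  LeftIndex : Game X → Set
  LeftIndex (atom x) = ⊥
  LeftIndex (comp I J i j L R) = I

  leftOption : (G : Game X) → LeftIndex G → Game X
  leftOption (comp I J i j L R) l = L l

  RightIndex : Game X → Set
  RightIndex (atom x) = ⊥
  RightIndex (comp I J i j L R) = J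

  rightOption : (G : Game X) → RightIndex G → Game X
  rightOption (comp I J i j L R) r = R r

  data IsAtom : Game X → Set a where
    atom : ∀ x → IsAtom (atom x)

  -- Lemmas that reach options only through leftOption and rightOption cannot
  -- recurse structurally on games; they recurse on this predicate (or on
  -- PassableView below) instead.
  data Accessible (G : Game X) : Set (a ⊔ lsuc 0ℓ) where
    acc : (∀ l → Accessible (leftOption G l)) → (∀ r → Accessible (rightOption G r)) → Accessible G

  accessible : ∀ G → Accessible G
  accessible (atom x) = acc (λ ()) (λ ())
  accessible (comp I J i j L R) = acc (λ l → accessible (L l)) (λ r → accessible (R r))

module GameOrder {a ℓ : Level} {X : Set a} (_≼_ : X → X → Set ℓ) where

  data AtomLe : Game X → Game X → Set (a ⊔ ℓ) where
    atom≼atom : ∀ {x y} → x ≼ y → AtomLe (atom x) (atom y)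

  -- The three clauses of ▷ from the paper, which Defs spreads over the
  -- atom/comp cases of G and H.
  data TrView (G H : Game X) : Set (a ⊔ ℓ) where
    right≤ : (r : RightIndex G) → Le _≼_ (rightOption G r) H → TrView G H
    ≤left  : (l : LeftIndex H) → Le _≼_ G (leftOption H l) → TrView G H
    atoms  : AtomLe G H → TrView G H

  Tr⇒TrView : ∀ {G H} → Tr _≼_ G H → TrView G H
  Tr⇒TrView {atom x} {atom y} x≼y = atoms (atom≼atom (lower x≼y))
  Tr⇒TrView {atom x} {comp _ _ _ _ _ _} (l , x≤Hˡ) = ≤left l x≤Hˡ
  Tr⇒TrView {comp _ _ _ _ _ _} {atom y} (r , Gʳ≤y) = right≤ r Gʳ≤y
  Tr⇒TrView {comp _ _ _ _ _ _} {comp _ _ _ _ _ _} (inj₁ (r , Gʳ≤H)) = right≤ r Gʳ≤H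
  Tr⇒TrView {comp _ _ _ _ _ _} {comp _ _ _ _ _ _} (inj₂ (l , G≤Hˡ)) = ≤left l G≤Hˡ

  TrView⇒Tr : ∀ {G H} → TrView G H → Tr _≼_ G H
  TrView⇒Tr {comp _ _ _ _ _ _} {atom y} (right≤ r Gʳ≤y) = r , Gʳ≤y
  TrView⇒Tr {comp _ _ _ _ _ _} {comp _ _ _ _ _ _} (right≤ r Gʳ≤H) = inj₁ (r , Gʳ≤H)
  TrView⇒Tr {atom x} {comp _ _ _ _ _ _} (≤left l x≤Hˡ) = l , x≤Hˡ
  TrView⇒Tr {comp _ _ _ _ _ _} {comp _ _ _ _ _ _} (≤left l G≤Hˡ) = inj₂ (l , G≤Hˡ)
  TrView⇒Tr (atoms (atom≼atom x≼y)) = lift x≼y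

  Le-leftOption : ∀ {G H} → Le _≼_ G H → ∀ l → Tr _≼_ (leftOption G l) H
  Le-leftOption {comp _ _ _ _ _ _} {atom y} (G≤y , _) = G≤y
  Le-leftOption {comp _ _ _ _ _ _} {comp _ _ _ _ _ _} (Gˡ▷H , _) = Gˡ▷H

  Le-rightOption : ∀ {G H} → Le _≼_ G H → ∀ r → Tr _≼_ G (rightOption H r)
  Le-rightOption {atom x} {comp _ _ _ _ _ _} (x▷Hʳ , _) = x▷Hʳ
  Le-rightOption {comp _ _ _ _ _ _} {comp _ _ _ _ _ _} (_ , G▷Hʳ) = G▷Hʳ

  Le-atomic : ∀ {G H} → Le _≼_ G H → IsAtom G ⊎ IsAtom H → Tr _≼_ G H
  Le-atomic {atom x} {atom y} x▷y _ = x▷y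
  Le-atomic {atom x} {comp _ _ _ _ _ _} (_ , x▷H) _ = x▷H
  Le-atomic {comp _ _ _ _ _ _} {atom y} (_ , G▷y) _ = G▷y
  Le-atomic {comp _ _ _ _ _ _} {comp _ _ _ _ _ _} _ (inj₁ ())
  Le-atomic {comp _ _ _ _ _ _} {comp _ _ _ _ _ _} _ (inj₂ ())

  Le-intro : ∀ G H → (∀ l → Tr _≼_ (leftOption G l) H) → (∀ r → Tr _≼_ G (rightOption H r)) →
             (IsAtom G ⊎ IsAtom H → Tr _≼_ G H) → Le _≼_ G H
  Le-intro (atom x) (atom y) _ _ atomic = atomic (inj₁ (atom x))
  Le-intro (atom x) (comp _ _ _ _ _ _) _ right atomic = right , atomic (inj₁ (atom x))
  Le-intro (comp _ _ _ _ _ _) (atom y) left _ atomic = left , atomic (inj₂ (atom y))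
  Le-intro (comp _ _ _ _ _ _) (comp _ _ _ _ _ _) left right _ = left , right

  AtomLe⇒Le : ∀ {G H} → AtomLe G H → Le _≼_ G H
  AtomLe⇒Le (atom≼atom x≼y) = lift x≼y

  data PassableView (G : Game X) : Set (a ⊔ ℓ ⊔ lsuc 0ℓ) where
    passable : Tr _≼_ G G → (∀ l → PassableView (leftOption G l)) →
               (∀ r → PassableView (rightOption G r)) → PassableView G

  Passable⇒PassableView : ∀ {G} → Passable _≼_ G → PassableView G
  Passable⇒PassableView {atom x} x▷x = passable x▷x (λ ()) (λ ())
  Passable⇒PassableView {comp _ _ _ _ L R} (G▷G , Lpassable , Rpassable) =
    passable G▷G (λ l → Passable⇒PassableView {L l} (Lpassable l))
                 (λ r → Passable⇒PassableView {R r} (Rpassable r))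

  module _ (≼-trans : Transitive _≼_) where

    AtomLe-trans : ∀ {G H K} → AtomLe G H → AtomLe H K → AtomLe G K
    AtomLe-trans (atom≼atom x≼y) (atom≼atom y≼z) = atom≼atom (≼-trans x≼y y≼z)

    -- Case splits on a view go through separate *-TrView-* functions: with
    -- `with` instead, the termination checker rejects this mutual block.
    mutual
      Le-trans : ∀ {G H K} → Accessible G → Accessible H → Accessible K →
                 Le _≼_ G H → Le _≼_ H K → Le _≼_ G K
      Le-trans {G} {H} {K} aG@(acc Gˡ _) aH aK@(acc _ Kʳ) G≤H H≤K = Le-intro G K
        (λ l → Tr-Le-trans (Gˡ l) aH aK (Le-leftOption {G} G≤H l) H≤K)
        (λ r → Le-Tr-trans aG aH (Kʳ r) G≤H (Le-rightOption H≤K r))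
        [ (λ G-atom → Tr-Le-trans aG aH aK (Le-atomic G≤H (inj₁ G-atom)) H≤K)
        , (λ K-atom → Le-Tr-trans aG aH aK G≤H (Le-atomic H≤K (inj₂ K-atom))) ]

      Le-Tr-trans : ∀ {G H K} → Accessible G → Accessible H → Accessible K →
                    Le _≼_ G H → Tr _≼_ H K → Tr _≼_ G K
      Le-Tr-trans aG aH aK G≤H H▷K = Le-TrView-trans aG aH aK G≤H (Tr⇒TrView H▷K)

      Le-TrView-trans : ∀ {G H K} → Accessible G → Accessible H → Accessible K →
                        Le _≼_ G H → TrView H K → Tr _≼_ G K
      Le-TrView-trans aG (acc _ Hʳ) aK G≤H (right≤ r Hʳ≤K) =
        Tr-Le-trans aG (Hʳ r) aK (Le-rightOption G≤H r) Hʳ≤K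
      Le-TrView-trans aG aH (acc Kˡ _) G≤H (≤left l H≤Kˡ) =
        TrView⇒Tr (≤left l (Le-trans aG aH (Kˡ l) G≤H H≤Kˡ))
      Le-TrView-trans aG aH aK G≤H (atoms H≼K@(atom≼atom _)) =
        TrView-AtomLe-trans aG aH aK (Tr⇒TrView (Le-atomic G≤H (inj₂ (atom _)))) H≼K

      Tr-Le-trans : ∀ {G H K} → Accessible G → Accessible H → Accessible K →
                    Tr _≼_ G H → Le _≼_ H K → Tr _≼_ G K
      Tr-Le-trans aG aH aK G▷H H≤K = TrView-Le-trans aG aH aK (Tr⇒TrView G▷H) H≤K

      TrView-Le-trans : ∀ {G H K} → Accessible G → Accessible H → Accessible K →
                        TrView G H → Le _≼_ H K → Tr _≼_ G K
      TrView-Le-trans (acc _ Gʳ) aH aK (right≤ r Gʳ≤H) H≤K =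
        TrView⇒Tr (right≤ r (Le-trans (Gʳ r) aH aK Gʳ≤H H≤K))
      TrView-Le-trans {H = H} aG (acc Hˡ _) aK (≤left l G≤Hˡ) H≤K =
        Le-Tr-trans aG (Hˡ l) aK G≤Hˡ (Le-leftOption {H} H≤K l)
      TrView-Le-trans aG aH aK (atoms G≼H@(atom≼atom _)) H≤K =
        AtomLe-TrView-trans aG aH aK G≼H (Tr⇒TrView (Le-atomic H≤K (inj₁ (atom _))))

      TrView-AtomLe-trans : ∀ {G H K} → Accessible G → Accessible H → Accessible K →
                            TrView G H → AtomLe H K → Tr _≼_ G K
      TrView-AtomLe-trans (acc _ Gʳ) aH aK (right≤ r Gʳ≤H) H≼K =
        TrView⇒Tr (right≤ r (Le-trans (Gʳ r) aH aK Gʳ≤H (AtomLe⇒Le H≼K)))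
      TrView-AtomLe-trans _ _ _ (≤left () _) (atom≼atom _)
      TrView-AtomLe-trans _ _ _ (atoms G≼H) H≼K = TrView⇒Tr (atoms (AtomLe-trans G≼H H≼K))

      AtomLe-TrView-trans : ∀ {G H K} → Accessible G → Accessible H → Accessible K →
                            AtomLe G H → TrView H K → Tr _≼_ G K
      AtomLe-TrView-trans aG aH (acc Kˡ _) G≼H (≤left l H≤Kˡ) =
        TrView⇒Tr (≤left l (Le-trans aG aH (Kˡ l) (AtomLe⇒Le G≼H) H≤Kˡ))
      AtomLe-TrView-trans _ _ _ (atom≼atom _) (right≤ () _)
      AtomLe-TrView-trans _ _ _ G≼H (atoms H≼K) = TrView⇒Tr (atoms (AtomLe-trans G≼H H≼K))

    Le-passable⇒Tr : ∀ {G H} → Le _≼_ G H → PassableView H → Tr _≼_ G H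
    Le-passable⇒Tr {G} {H} G≤H (passable H▷H _ _) =
      Le-Tr-trans (accessible G) (accessible H) (accessible H) G≤H H▷H

module _ {a b : Level} {X : Set a} {Y : Set b} where

  ⊕-leftOption-elim : ∀ {p} (P : Game (X × Y) → Set p) {G H} →
                      (∀ l → P (leftOption G l ⊕ H)) → (∀ l → P (G ⊕ leftOption H l)) →
                      ∀ l → P (leftOption (G ⊕ H) l)
  ⊕-leftOption-elim P {atom x} {comp _ _ _ _ _ _} _ PHˡ = PHˡ
  ⊕-leftOption-elim P {comp _ _ _ _ _ _} {atom y} PGˡ _ = PGˡ
  ⊕-leftOption-elim P {comp _ _ _ _ _ _} {comp _ _ _ _ _ _} PGˡ PHˡ = [ PGˡ , PHˡ ]

  ⊕-rightOption-elim : ∀ {p} (P : Game (X × Y) → Set p) {G H} →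
                       (∀ r → P (rightOption G r ⊕ H)) → (∀ r → P (G ⊕ rightOption H r)) →
                       ∀ r → P (rightOption (G ⊕ H) r)
  ⊕-rightOption-elim P {atom x} {comp _ _ _ _ _ _} _ PHʳ = PHʳ
  ⊕-rightOption-elim P {comp _ _ _ _ _ _} {atom y} PGʳ _ = PGʳ
  ⊕-rightOption-elim P {comp _ _ _ _ _ _} {comp _ _ _ _ _ _} PGʳ PHʳ = [ PGʳ , PHʳ ]

  IsAtom-⊕⁻ : ∀ {G : Game X} {H : Game Y} → IsAtom (G ⊕ H) → IsAtom G × IsAtom H
  IsAtom-⊕⁻ {atom x} {atom y} _ = atom x , atom y
  IsAtom-⊕⁻ {atom x} {comp _ _ _ _ _ _} ()
  IsAtom-⊕⁻ {comp _ _ _ _ _ _} {atom y} ()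
  IsAtom-⊕⁻ {comp _ _ _ _ _ _} {comp _ _ _ _ _ _} ()

  module _ {ℓ : Level} (_≼_ : X × Y → X × Y → Set ℓ) where
    open GameOrder _≼_

    Tr-⊕-rightOptionˡ : ∀ {G H K} (r : RightIndex G) → Le _≼_ (rightOption G r ⊕ H) K → Tr _≼_ (G ⊕ H) K
    Tr-⊕-rightOptionˡ {comp _ _ _ _ _ _} {atom y} r = TrView⇒Tr ∘ right≤ r
    Tr-⊕-rightOptionˡ {comp _ _ _ _ _ _} {comp _ _ _ _ _ _} r = TrView⇒Tr ∘ right≤ (inj₁ r)

    Tr-⊕-rightOptionʳ : ∀ {G H K} (r : RightIndex H) → Le _≼_ (G ⊕ rightOption H r) K → Tr _≼_ (G ⊕ H) K
    Tr-⊕-rightOptionʳ {atom x} {comp _ _ _ _ _ _} r = TrView⇒Tr ∘ right≤ r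
    Tr-⊕-rightOptionʳ {comp _ _ _ _ _ _} {comp _ _ _ _ _ _} r = TrView⇒Tr ∘ right≤ (inj₂ r)

    Tr-⊕-leftOptionˡ : ∀ {G H K} (l : LeftIndex G) → Le _≼_ K (leftOption G l ⊕ H) → Tr _≼_ K (G ⊕ H)
    Tr-⊕-leftOptionˡ {comp _ _ _ _ _ _} {atom y} l = TrView⇒Tr ∘ ≤left l
    Tr-⊕-leftOptionˡ {comp _ _ _ _ _ _} {comp _ _ _ _ _ _} l = TrView⇒Tr ∘ ≤left (inj₁ l)

    Tr-⊕-leftOptionʳ : ∀ {G H K} (l : LeftIndex H) → Le _≼_ K (G ⊕ leftOption H l) → Tr _≼_ K (G ⊕ H)
    Tr-⊕-leftOptionʳ {atom x} {comp _ _ _ _ _ _} l = TrView⇒Tr ∘ ≤left l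
    Tr-⊕-leftOptionʳ {comp _ _ _ _ _ _} {comp _ _ _ _ _ _} l = TrView⇒Tr ∘ ≤left (inj₂ l)

module ⊕-Monotonicity {a b ℓ₁ ℓ₂ : Level} {X : Set a} {Y : Set b}
  {_≼₁_ : X → X → Set ℓ₁} {_≼₂_ : Y → Y → Set ℓ₂}
  (≼₁-trans : Transitive _≼₁_) (≼₂-trans : Transitive _≼₂_) where

  private
    _≼_ = ProdRel _≼₁_ _≼₂_
    module A = GameOrder _≼₁_
    module B = GameOrder _≼₂_
    module S = GameOrder _≼_

  open GameOrder using (atom≼atom; right≤; ≤left; atoms; passable)

  AtomLe-⊕ : ∀ {G G' H H'} → A.AtomLe G G' → B.AtomLe H H' → S.AtomLe (G ⊕ H) (G' ⊕ H')
  AtomLe-⊕ (atom≼atom x≼x') (atom≼atom y≼y') = atom≼atom (x≼x' , y≼y')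

  mutual
    ⊕-mono-Tr-Le : ∀ {G G' H H'} → A.PassableView G → A.PassableView G' → B.PassableView H → B.PassableView H' →
                   Tr _≼₁_ G G' → Le _≼₂_ H H' → Tr _≼_ (G ⊕ H) (G' ⊕ H')
    ⊕-mono-Tr-Le gG gG' gH gH' G▷G' H≤H' = ⊕-mono-TrView-Le gG gG' gH gH' (A.Tr⇒TrView G▷G') H≤H'

    ⊕-mono-TrView-Le : ∀ {G G' H H'} → A.PassableView G → A.PassableView G' → B.PassableView H → B.PassableView H' →
                       A.TrView G G' → Le _≼₂_ H H' → Tr _≼_ (G ⊕ H) (G' ⊕ H')
    ⊕-mono-TrView-Le (passable _ _ Gʳ) gG' gH gH' (right≤ r Gʳ≤G') H≤H' =
      Tr-⊕-rightOptionˡ _≼_ r (⊕-mono-Le (Gʳ r) gG' gH gH' Gʳ≤G' H≤H')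
    ⊕-mono-TrView-Le gG (passable _ G'ˡ _) gH gH' (≤left l G≤G'ˡ) H≤H' =
      Tr-⊕-leftOptionˡ _≼_ l (⊕-mono-Le gG (G'ˡ l) gH gH' G≤G'ˡ H≤H')
    ⊕-mono-TrView-Le gG gG' gH gH' (atoms G≼G') H≤H' =
      ⊕-mono-Le-Tr gG gG' gH gH' (A.AtomLe⇒Le G≼G') (B.Le-passable⇒Tr ≼₂-trans H≤H' gH')

    ⊕-mono-Le-Tr : ∀ {G G' H H'} → A.PassableView G → A.PassableView G' → B.PassableView H → B.PassableView H' →
                   Le _≼₁_ G G' → Tr _≼₂_ H H' → Tr _≼_ (G ⊕ H) (G' ⊕ H')
    ⊕-mono-Le-Tr gG gG' gH gH' G≤G' H▷H' = ⊕-mono-Le-TrView gG gG' gH gH' G≤G' (B.Tr⇒TrView H▷H')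

    ⊕-mono-Le-TrView : ∀ {G G' H H'} → A.PassableView G → A.PassableView G' → B.PassableView H → B.PassableView H' →
                       Le _≼₁_ G G' → B.TrView H H' → Tr _≼_ (G ⊕ H) (G' ⊕ H')
    ⊕-mono-Le-TrView gG gG' (passable _ _ Hʳ) gH' G≤G' (right≤ r Hʳ≤H') =
      Tr-⊕-rightOptionʳ _≼_ r (⊕-mono-Le gG gG' (Hʳ r) gH' G≤G' Hʳ≤H')
    ⊕-mono-Le-TrView gG gG' gH (passable _ H'ˡ _) G≤G' (≤left l H≤H'ˡ) =
      Tr-⊕-leftOptionʳ _≼_ l (⊕-mono-Le gG gG' gH (H'ˡ l) G≤G' H≤H'ˡ)
    ⊕-mono-Le-TrView gG gG' gH gH' G≤G' (atoms H≼H') =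
      ⊕-mono-TrView-AtomLe gG gG' gH gH' (A.Tr⇒TrView (A.Le-passable⇒Tr ≼₁-trans G≤G' gG')) H≼H'

    ⊕-mono-TrView-AtomLe : ∀ {G G' H H'} → A.PassableView G → A.PassableView G' → B.PassableView H → B.PassableView H' →
                           A.TrView G G' → B.AtomLe H H' → Tr _≼_ (G ⊕ H) (G' ⊕ H')
    ⊕-mono-TrView-AtomLe (passable _ _ Gʳ) gG' gH gH' (right≤ r Gʳ≤G') H≼H' =
      Tr-⊕-rightOptionˡ _≼_ r (⊕-mono-Le (Gʳ r) gG' gH gH' Gʳ≤G' (B.AtomLe⇒Le H≼H'))
    ⊕-mono-TrView-AtomLe gG (passable _ G'ˡ _) gH gH' (≤left l G≤G'ˡ) H≼H' =
      Tr-⊕-leftOptionˡ _≼_ l (⊕-mono-Le gG (G'ˡ l) gH gH' G≤G'ˡ (B.AtomLe⇒Le H≼H'))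
    ⊕-mono-TrView-AtomLe _ _ _ _ (atoms G≼G') H≼H' = S.TrView⇒Tr (atoms (AtomLe-⊕ G≼G' H≼H'))

    ⊕-mono-Le : ∀ {G G' H H'} → A.PassableView G → A.PassableView G' → B.PassableView H → B.PassableView H' →
                Le _≼₁_ G G' → Le _≼₂_ H H' → Le _≼_ (G ⊕ H) (G' ⊕ H')
    ⊕-mono-Le {G} {G'} {H} {H'} gG@(passable _ Gˡ _) gG'@(passable _ _ G'ʳ)
                                gH@(passable _ Hˡ _) gH'@(passable _ _ H'ʳ) G≤G' H≤H' =
      S.Le-intro (G ⊕ H) (G' ⊕ H')
        (⊕-leftOption-elim (λ K → Tr _≼_ K (G' ⊕ H'))
          (λ l → ⊕-mono-Tr-Le (Gˡ l) gG' gH gH' (A.Le-leftOption {G} G≤G' l) H≤H')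
          (λ l → ⊕-mono-Le-Tr gG gG' (Hˡ l) gH' G≤G' (B.Le-leftOption {H} H≤H' l)))
        (⊕-rightOption-elim (λ K → Tr _≼_ (G ⊕ H) K)
          (λ r → ⊕-mono-Tr-Le gG (G'ʳ r) gH gH' (A.Le-rightOption G≤G' r) H≤H')
          (λ r → ⊕-mono-Le-Tr gG gG' gH (H'ʳ r) G≤G' (B.Le-rightOption H≤H' r)))
        [ (λ G⊕H-atom → ⊕-mono-Tr-Le gG gG' gH gH' (A.Le-atomic G≤G' (inj₁ (proj₁ (IsAtom-⊕⁻ G⊕H-atom)))) H≤H')
        , (λ G'⊕H'-atom → ⊕-mono-Tr-Le gG gG' gH gH' (A.Le-atomic G≤G' (inj₂ (proj₁ (IsAtom-⊕⁻ G'⊕H'-atom)))) H≤H') ]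

  ⊕-cong : ∀ {G G' H H'} → A.PassableView G → A.PassableView G' → B.PassableView H → B.PassableView H' →
           Equiv _≼₁_ G G' → Equiv _≼₂_ H H' → Equiv _≼_ (G ⊕ H) (G' ⊕ H')
  ⊕-cong gG gG' gH gH' (G≤G' , G'≤G) (H≤H' , H'≤H) =
    ⊕-mono-Le gG gG' gH gH' G≤G' H≤H' , ⊕-mono-Le gG' gG gH' gH G'≤G H'≤H

corollary8p5 : {a ℓ₁ ℓ₂ b ℓ₃ ℓ₄ : Level} (A : Poset a ℓ₁ ℓ₂) (B : Poset b ℓ₃ ℓ₄)
  (G G' : Game (Poset.Carrier A)) (H H' : Game (Poset.Carrier B)) →
  Passable (Poset._≤_ A) G → Passable (Poset._≤_ A) G' →
  Passable (Poset._≤_ B) H → Passable (Poset._≤_ B) H' →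
  ((Tr (Poset._≤_ A) G G' → Le (Poset._≤_ B) H H' →
      Tr (ProdRel (Poset._≤_ A) (Poset._≤_ B)) (G ⊕ H) (G' ⊕ H'))
  × (Le (Poset._≤_ A) G G' → Tr (Poset._≤_ B) H H' →
      Tr (ProdRel (Poset._≤_ A) (Poset._≤_ B)) (G ⊕ H) (G' ⊕ H'))
  × (Le (Poset._≤_ A) G G' → Le (Poset._≤_ B) H H' →
      Le (ProdRel (Poset._≤_ A) (Poset._≤_ B)) (G ⊕ H) (G' ⊕ H'))
  × (Equiv (Poset._≤_ A) G G' → Equiv (Poset._≤_ B) H H' →
      Equiv (ProdRel (Poset._≤_ A) (Poset._≤_ B)) (G ⊕ H) (G' ⊕ H')))
corollary8p5 A B G G' H H' pG pG' pH pH' =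
  ⊕-mono-Tr-Le gG gG' gH gH' , ⊕-mono-Le-Tr gG gG' gH gH' , ⊕-mono-Le gG gG' gH gH' , ⊕-cong gG gG' gH gH'
  where
  open ⊕-Monotonicity (Poset.trans A) (Poset.trans B)
  open GameOrder using (PassableView; Passable⇒PassableView)

  gG : PassableView (Poset._≤_ A) G
  gG = Passable⇒PassableView (Poset._≤_ A) pG

  gG' : PassableView (Poset._≤_ A) G'
  gG' = Passable⇒PassableView (Poset._≤_ A) pG'

  gH : PassableView (Poset._≤_ B) H
  gH = Passable⇒PassableView (Poset._≤_ B) pH

  gH' : PassableView (Poset._≤_ B) H'
  gH' = Passable⇒PassableView (Poset._≤_ B) pH'
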